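{- Let $E=K\times K$ and let $L$ be a hermitian lattice over $E$. Let $(u,v)$ be a hyperbolic pair splitting $L$ and $P=\mathcal{O}u\oplus\mathcal{O}v$. Then every rescaled Eichler isometry of $L$ with respect to $(u,v)$ is a product of two symmetries of $L$ and an element of $U(L)$ that fixes $P$ pointwise.
   Context: $K$ is a non-Archimedean local field of characteristic zero with valuation ring $\mathfrak{o}$. On $E=K\times K$ the involution is $(a,b)\mapsto(b,a)$, trace $\mathrm{Tr}(\alpha)=\alpha+\bar\alpha$, $\mathcal{O}=\mathfrak{o}\times\mathfrak{o}$. A hermitian lattice is a finitely generated $\mathcal{O}$-submodule $L$ of a finitely generated free $E$-module $V$ with $\langle\cdot,\cdot\rangle:V\times V\to E$, $E$-linear in the first argument, $\langle x,y\rangle=\overline{\langle y,x\rangle}$; non-degenerate. $U(L)=\{f\in U(V):f(L)=L\}$. A symmetry of $L$ is a map $S_{s,\sigma}(x)=x-\langle x,s\rangle\sigma^{ -1}s$ ($s\in V$, $\sigma\in E^\times$, $\langle s,s\rangle=\mathrm{Tr}(\sigma)$) lying in $U(L)$. A hyperbolic pair splitting $L$ is a pair $(u,v)$ of linearly independent elements of $L$ with $\langle u,u\rangle=\langle v,v\rangle=0$ and $L=P\perp P^\perp$, where $P=\mathcal{O}u\oplus\mathcal{O}v$ and $P^\perp=\{x\in L:\langle x,P\rangle=0\}$. For $y\in P^\perp$ with $\langle L,y\rangle\subseteq\langle u,v\rangle\mathcal{O}$ and $\mu\in\mathcal{O}$ with $\mathrm{Tr}(\mu\langle u,v\rangle)=-\langle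 y,y\rangle$, the rescaled Eichler isometry with respect to $(u,v)$ is $E^\mu_y(x)=x+\frac{\langle x,u\rangle}{\langle v,u\rangle}y+\Big(\frac{\mu\langle x,u\rangle}{\langle v,u\rangle}-\frac{\langle x,y\rangle}{\langle u,v\rangle}\Big)u$, an element of $U(L)$. -}

module Defs where

open import Level using (0ℓ)
open import Algebra.Bundles using (CommutativeRing)
import Algebra.Definitions.RawMonoid as RM
open import Data.Nat as ℕ using (ℕ; zero; suc)
open import Data.Integer as ℤ using (ℤ; +_)
open import Data.Fin using (Fin)
open import Data.List using (List)
open import Data.List.Membership.Propositional using (_∈_)
open import Data.Product using (Σ; ∃; _×_; _,_; proj₁; proj₂)
open import Relation.Nullary using (¬_)
open import Relation.Binary.PropositionalEquality using (_≡_)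

data ℤ∞ : Set where
  fin : ℤ → ℤ∞
  ∞   : ℤ∞

_+∞_ : ℤ∞ → ℤ∞ → ℤ∞
fin a +∞ fin b = fin (a ℤ.+ b)
fin _ +∞ ∞     = ∞
∞     +∞ _     = ∞

data _≤∞_ : ℤ∞ → ℤ∞ → Set where
  fin≤fin : ∀ {a b} → a ℤ.≤ b → fin a ≤∞ fin b
  _≤∞∞    : ∀ x → x ≤∞ ∞

-- min(a,b) ≤ c, written without defining min
MinLe : ℤ∞ → ℤ∞ → ℤ∞ → Set
MinLe a b c = (a ≤∞ c) Data.Sum.⊎ (b ≤∞ c)
  where import Data.Sum

record NALocalField : Set₁ where
  field
    ring : CommutativeRing 0ℓ 0ℓ
  open CommutativeRing ring public
    using (Carrier; _≈_; _+_; _*_; -_; _-_; 0#; 1#; +-rawMonoid)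
  field
    1≉0    : ¬ (1# ≈ 0#)
    inv    : ∀ x → ¬ (x ≈ 0#) → Σ Carrier λ y → x * y ≈ 1#
    char0  : ∀ n → (RM._×_ +-rawMonoid n 1#) ≈ 0# → n ≡ ℕ.zero
    val      : Carrier → ℤ∞
    val-cong : ∀ {x y} → x ≈ y → val x ≡ val y
    val-∞    : ∀ x → (val x ≡ ∞ → x ≈ 0#) × (x ≈ 0# → val x ≡ ∞)
    val-*    : ∀ x y → val (x * y) ≡ val x +∞ val y
    val-+    : ∀ x y → MinLe (val x) (val y) (val (x + y))
    val-surj : ∀ (n : ℤ) → Σ Carrier λ x → val x ≡ fin n
    complete : (a : ℕ → Carrier) →
               (∀ (N : ℕ) → Σ ℕ λ M → ∀ m n → M ℕ.≤ m → M ℕ.≤ n →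
                  fin (+ N) ≤∞ val (a m - a n)) →
               Σ Carrier λ l → ∀ (N : ℕ) → Σ ℕ λ M → ∀ n → M ℕ.≤ n →
                  fin (+ N) ≤∞ val (a n - l)
    -- finite residue field: finitely many elements of 𝔬 represent 𝔬/𝔪
    residues    : List Carrier
    residues-𝔬  : ∀ r → r ∈ residues → fin (+ 0) ≤∞ val r
    residues-all : ∀ x → fin (+ 0) ≤∞ val x →
                   Σ Carrier λ r → r ∈ residues × (fin (+ 1) ≤∞ val (x - r))

  In𝔬 : Carrier → Set
  In𝔬 x = fin (+ 0) ≤∞ val x

module Hermitian (K : NALocalField) where
  open NALocalField K
    renaming (Carrier to Kc; _≈_ to _≈K_; _+_ to _+K_; _*_ to _*K_;
              -_ to -K_; 0# to 0K; 1# to 1K)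
    using (In𝔬)

  E : Set
  E = Kc × Kc

  _≈E_ : E → E → Set
  (a , b) ≈E (c , d) = (a ≈K c) × (b ≈K d)

  _+E_ _*E_ : E → E → E
  (a , b) +E (c , d) = (a +K c) , (b +K d)
  (a , b) *E (c , d) = (a *K c) , (b *K d)

  -E_ : E → E
  -E (a , b) = (-K a) , (-K b)

  _-E_ : E → E → E
  α -E β = α +E (-E β)

  0E 1E : E
  0E = 0K , 0K
  1E = 1K , 1K

  bar : E → E
  bar (a , b) = b , a

  Tr : E → E
  Tr α = α +E bar α

  In𝒪 : E → Set
  In𝒪 (a , b) = In𝔬 a × In𝔬 b

  -- V = E^n, a finitely generated free E-module (any such is ≅ E^n)
  V : ℕ → Set
  V n = Fin n → E

  module _ {n : ℕ} where
    _≈V_ : V n → V n → Set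
    x ≈V y = ∀ i → x i ≈E y i

    _+V_ : V n → V n → V n
    (x +V y) i = x i +E y i

    _-V_ : V n → V n → V n
    (x -V y) i = x i -E y i

    _·_ : E → V n → V n
    (c · x) i = c *E x i

    0V : V n
    0V i = 0E

  sumV : ∀ {n m} → (Fin m → V n) → V n
  sumV {m = zero}  f = 0V
  sumV {m = suc m} f = f Fin.zero +V sumV (λ i → f (Fin.suc i))
    where import Data.Fin as Fin

  record HermitianSpace : Set where
    field
      n      : ℕ
      ⟨_,_⟩  : V n → V n → E
      ⟨⟩-cong : ∀ {x x' y y'} → x ≈V x' → y ≈V y' → ⟨ x , y ⟩ ≈E ⟨ x' , y' ⟩
      ⟨⟩-+    : ∀ x x' y → ⟨ x +V x' , y ⟩ ≈E (⟨ x , y ⟩ +E ⟨ x' , y ⟩)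
      ⟨⟩-·    : ∀ c x y → ⟨ c · x , y ⟩ ≈E (c *E ⟨ x , y ⟩)
      ⟨⟩-herm : ∀ x y → ⟨ x , y ⟩ ≈E bar ⟨ y , x ⟩
      nondeg  : ∀ x → (∀ y → ⟨ x , y ⟩ ≈E 0E) → x ≈V 0V

  module Lattices (H : HermitianSpace) where
    open HermitianSpace H

    -- a hermitian lattice: the 𝒪-span of finitely many vectors of V
    record Lattice : Set where
      field
        m    : ℕ
        gens : Fin m → V n

    _∈L_ : V n → Lattice → Set
    x ∈L L = Σ (Fin (Lattice.m L) → E) λ c →
               (∀ i → In𝒪 (c i)) × (x ≈V sumV (λ i → c i · Lattice.gens L i))

    record InUV (f : V n → V n) : Set where
      field
        cong   : ∀ {x y} → x ≈V y → f x ≈V f y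
        additive : ∀ x y → f (x +V y) ≈V (f x +V f y)
        homog  : ∀ c x → f (c · x) ≈V (c · f x)
        inj    : ∀ x y → f x ≈V f y → x ≈V y
        surj   : ∀ y → Σ (V n) λ x → f x ≈V y
        isom   : ∀ x y → ⟨ f x , f y ⟩ ≈E ⟨ x , y ⟩

    record InUL (L : Lattice) (f : V n → V n) : Set where
      field
        unitary : InUV f
        maps    : ∀ x → x ∈L L → f x ∈L L
        onto    : ∀ y → y ∈L L → Σ (V n) λ x → x ∈L L × (f x ≈V y)

    -- the map S_{s,σ}, with σ' the inverse of σ
    S : V n → E → V n → V n
    S s σ' x = x -V ((⟨ x , s ⟩ *E σ') · s)

    IsSymmetry : Lattice → (V n → V n) → Set
    IsSymmetry L f =
      Σ (V n) λ s → Σ E λ σ → Σ E λ σ' →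
        ((σ *E σ') ≈E 1E) × (⟨ s , s ⟩ ≈E Tr σ) ×
        (∀ x → f x ≈V S s σ' x) × InUL L f

    _∈P[_,_] : V n → V n → V n → Set
    x ∈P[ u , v ] = Σ E λ a → Σ E λ b → In𝒪 a × In𝒪 b × (x ≈V ((a · u) +V (b · v)))

    _∈P⊥[_,_,_] : V n → Lattice → V n → V n → Set
    x ∈P⊥[ L , u , v ] = x ∈L L × (∀ p → p ∈P[ u , v ] → ⟨ x , p ⟩ ≈E 0E)

    record HyperbolicSplitting (L : Lattice) (u v : V n) : Set where
      field
        u∈L   : u ∈L L
        v∈L   : v ∈L L
        indep : ∀ a b → ((a · u) +V (b · v)) ≈V 0V → (a ≈E 0E) × (b ≈E 0E)
        u-iso : ⟨ u , u ⟩ ≈E 0E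
        v-iso : ⟨ v , v ⟩ ≈E 0E
        -- L = P ⊥ P^⊥ (internal orthogonal direct sum)
        spans : ∀ x → x ∈L L → Σ (V n) λ p → Σ (V n) λ q →
                  p ∈P[ u , v ] × q ∈P⊥[ L , u , v ] × (x ≈V (p +V q))
        direct : ∀ x → x ∈P[ u , v ] → x ∈P⊥[ L , u , v ] → x ≈V 0V

    -- the rescaled Eichler map E^μ_y w.r.t. (u,v), where w = ⟨v,u⟩⁻¹
    -- (so bar w = ⟨u,v⟩⁻¹)
    Eichler : (u v y : V n) (μ w : E) → V n → V n
    Eichler u v y μ w x =
      (x +V ((⟨ x , u ⟩ *E w) · y))
        +V (((μ *E (⟨ x , u ⟩ *E w)) -E (⟨ x , y ⟩ *E bar w)) · u)

-- Write ε = (1 , 0) for the idempotent of E = K × K.  The first coordinate of ⟨ x , z ⟩ only sees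
-- the ε-part of x and the (1 - ε)-part of z, so ⟨ ε p + (1 - ε) q , ε p + (1 - ε) q ⟩ is
-- (⟨ p , q ⟩₁ , ⟨ q , p ⟩₂), which vanishes when p ⊥ q.  Hence s₂ = ε u + (1 - ε) y and
-- s₁ = ε (y + μ u) + (1 - ε) u are isotropic, and for skew c = (t , - t) the transvection
-- x ↦ x - ⟨ x , s ⟩ c s is a symmetry.  With w = ⟨ v , u ⟩⁻¹, c₂ = (w₂ , - w₂) and
-- c₁ = (- w₁ , w₁), a coordinatewise computation gives E^μ_y = S₁ ∘ S₂: the first coordinates
-- agree identically, the second ones by Tr (μ ⟨ u , v ⟩) = - ⟨ y , y ⟩ multiplied by w w̄.  Both
-- transvections preserve L since ⟨ x , u ⟩ ∈ ⟨ v , u ⟩ 𝒪 (from L = P ⊥ P^⊥) and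
-- ⟨ x , y ⟩ ∈ ⟨ u , v ⟩ 𝒪 for x ∈ L; so the factor fixing P can be taken to be the identity.

module Submission where

open import Defs
open import Data.Product using (Σ; _×_; _,_; proj₁; proj₂)

open import Level using (0ℓ)
open import Algebra.Bundles using (CommutativeRing)
import Algebra.Construct.DirectProduct as DirectProduct
import Algebra.Properties.CommutativeSemigroup as CommutativeSemigroupProperties
import Algebra.Solver.Ring.AlmostCommutativeRing as ACR
open import Data.Empty using (⊥-elim)
open import Data.Fin using (Fin; zero; suc)
open import Data.Integer as ℤ using (ℤ; +_; -[1+_]; _⊖_; _◃_; sign; ∣_∣)
import Data.Integer.Properties as ℤ
open import Data.Maybe using (Maybe; just; nothing)
open import Data.Nat as ℕ using (zero; suc)
import Data.Nat.Properties as ℕ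
open import Data.Sign as Sign using (Sign)
open import Data.Sum using (inj₁; inj₂)
import Data.Vec.Functional.Relation.Binary.Pointwise.Properties as Pointwise
open import Function using (_∘_)
open import Relation.Binary.Bundles using (Setoid)
open import Relation.Binary.PropositionalEquality as ≡ using (_≡_)
open import Relation.Nullary using (yes; no)

-- Normal forms of Algebra.Solver.Ring only cancel when coefficient equality is decidable, which an
-- arbitrary commutative ring lacks, so the coefficients are taken from ℤ.
module IntegerCoefficients {c ℓ} (R : CommutativeRing c ℓ) where
  open CommutativeRing R
  open import Algebra.Properties.Semiring.Mult.TCOptimised semiring using (1+×; ×-homo-+; ×1-homo-*)
    renaming (_×_ to _×′_)
  open import Algebra.Properties.Ring ring using (-‿involutive; -0#≈0#; -1*x≈-x; -‿+-comm)
  open import Relation.Binary.Reasoning.Setoid setoid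

  -- With the optimised multiple _×′_, con (+ 0) and con (+ 1) denote 0# and 1# definitionally.
  ⟦_⟧ℤ : ℤ → Carrier
  ⟦ + n ⟧ℤ     = n ×′ 1#
  ⟦ -[1+ n ] ⟧ℤ = - (suc n ×′ 1#)

  ⟦_⟧± : Sign → Carrier
  ⟦ Sign.+ ⟧± = 1#
  ⟦ Sign.- ⟧± = - 1#

  private
    ≈-by : ∀ {i j} → i ≡ j → ⟦ i ⟧ℤ ≈ ⟦ j ⟧ℤ
    ≈-by ≡.refl = refl

    cancel-1 : ∀ x y → (1# + x) - (1# + y) ≈ x - y
    cancel-1 x y = begin
      (1# + x) - (1# + y)       ≈⟨ +-cong (+-comm 1# x) (sym (-‿+-comm 1# y)) ⟩
      (x + 1#) + (- 1# + - y)   ≈⟨ +-assoc x 1# _ ⟩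
      x + (1# + (- 1# + - y))   ≈⟨ +-cong refl (sym (+-assoc 1# (- 1#) (- y))) ⟩
      x + ((1# - 1#) + - y)     ≈⟨ +-cong refl (+-cong (-‿inverseʳ 1#) refl) ⟩
      x + (0# + - y)            ≈⟨ +-cong refl (+-identityˡ (- y)) ⟩
      x - y                     ∎

  ⊖-homo : ∀ m n → ⟦ m ⊖ n ⟧ℤ ≈ m ×′ 1# - n ×′ 1#
  ⊖-homo m       zero    = sym (trans (+-cong refl -0#≈0#) (+-identityʳ _))
  ⊖-homo zero    (suc n) = sym (+-identityˡ _)
  ⊖-homo (suc m) (suc n) = begin
    ⟦ suc m ⊖ suc n ⟧ℤ  ≈⟨ ≈-by (ℤ.[1+m]⊖[1+n]≡m⊖n m n) ⟩
    ⟦ m ⊖ n ⟧ℤ          ≈⟨ ⊖-homo m n ⟩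
    m ×′ 1# - n ×′ 1#     ≈⟨ cancel-1 _ _ ⟨
    (1# + m ×′ 1#) - (1# + n ×′ 1#) ≈⟨ +-cong (1+× m 1#) (-‿cong (1+× n 1#)) ⟨
    suc m ×′ 1# - suc n ×′ 1# ∎

  +-homo : ∀ i j → ⟦ i ℤ.+ j ⟧ℤ ≈ ⟦ i ⟧ℤ + ⟦ j ⟧ℤ
  +-homo (+ m)    (+ n)    = ×-homo-+ 1# m n
  +-homo (+ m)    -[1+ n ] = ⊖-homo m (suc n)
  +-homo -[1+ m ] (+ n)    = trans (⊖-homo n (suc m)) (+-comm _ _)
  +-homo -[1+ m ] -[1+ n ] = begin
    - (suc (suc (m ℕ.+ n)) ×′ 1#)     ≈⟨ -‿cong (reflexive (≡.cong (λ k → suc k ×′ 1#) (ℕ.+-suc m n))) ⟨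
    - ((suc m ℕ.+ suc n) ×′ 1#)       ≈⟨ -‿cong (×-homo-+ 1# (suc m) (suc n)) ⟩
    - (suc m ×′ 1# + suc n ×′ 1#)      ≈⟨ -‿+-comm _ _ ⟨
    ⟦ -[1+ m ] ⟧ℤ + ⟦ -[1+ n ] ⟧ℤ     ∎

  ◃-homo : ∀ s n → ⟦ s ◃ n ⟧ℤ ≈ ⟦ s ⟧± * (n ×′ 1#)
  ◃-homo s        zero    = sym (zeroʳ _)
  ◃-homo Sign.+   (suc n) = sym (*-identityˡ _)
  ◃-homo Sign.-   (suc n) = sym (-1*x≈-x _)

  sign-*-homo : ∀ s t → ⟦ s Sign.* t ⟧± ≈ ⟦ s ⟧± * ⟦ t ⟧±
  sign-*-homo Sign.+ t      = sym (*-identityˡ _)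
  sign-*-homo Sign.- Sign.+ = sym (*-identityʳ _)
  sign-*-homo Sign.- Sign.- = sym (trans (-1*x≈-x (- 1#)) (-‿involutive 1#))

  *-homo : ∀ i j → ⟦ i ℤ.* j ⟧ℤ ≈ ⟦ i ⟧ℤ * ⟦ j ⟧ℤ
  *-homo i j = begin
    ⟦ sign i Sign.* sign j ◃ ∣ i ∣ ℕ.* ∣ j ∣ ⟧ℤ                ≈⟨ ◃-homo (sign i Sign.* sign j) (∣ i ∣ ℕ.* ∣ j ∣) ⟩
    ⟦ sign i Sign.* sign j ⟧± * ((∣ i ∣ ℕ.* ∣ j ∣) ×′ 1#)       ≈⟨ *-cong (sign-*-homo (sign i) (sign j)) (×1-homo-* ∣ i ∣ ∣ j ∣) ⟩
    (⟦ sign i ⟧± * ⟦ sign j ⟧±) * (∣ i ∣ ×′ 1# * ∣ j ∣ ×′ 1#)    ≈⟨ interchange ⟩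
    (⟦ sign i ⟧± * ∣ i ∣ ×′ 1#) * (⟦ sign j ⟧± * ∣ j ∣ ×′ 1#)    ≈⟨ *-cong (◃-homo (sign i) ∣ i ∣) (◃-homo (sign j) ∣ j ∣) ⟨
    ⟦ sign i ◃ ∣ i ∣ ⟧ℤ * ⟦ sign j ◃ ∣ j ∣ ⟧ℤ                   ≈⟨ *-cong (≈-by (ℤ.◃-inverse i)) (≈-by (ℤ.◃-inverse j)) ⟩
    ⟦ i ⟧ℤ * ⟦ j ⟧ℤ                                            ∎
    where
    interchange : ∀ {a b x y} → (a * b) * (x * y) ≈ (a * x) * (b * y)
    interchange = CommutativeSemigroupProperties.interchange *-commutativeSemigroup _ _ _ _

  -‿homo : ∀ i → ⟦ ℤ.- i ⟧ℤ ≈ - ⟦ i ⟧ℤ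
  -‿homo (+ zero)  = sym -0#≈0#
  -‿homo (+ suc n) = refl
  -‿homo -[1+ n ]  = sym (-‿involutive _)

  morphism : ℤ.+-*-rawRing ACR.-Raw-AlmostCommutative⟶ ACR.fromCommutativeRing R
  morphism = record
    { ⟦_⟧ = ⟦_⟧ℤ ; +-homo = +-homo ; *-homo = *-homo ; -‿homo = -‿homo
    ; 0-homo = refl ; 1-homo = refl }

  coefficient≟ : ∀ i j → Maybe (⟦ i ⟧ℤ ≈ ⟦ j ⟧ℤ)
  coefficient≟ i j with i ℤ.≟ j
  ... | yes i≡j = just (≈-by i≡j)
  ... | no _    = nothing

  open import Algebra.Solver.Ring ℤ.+-*-rawRing (ACR.fromCommutativeRing R) morphism coefficient≟ public

module InverseLemmas {r ℓ} (R : CommutativeRing r ℓ) where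
  open CommutativeRing R
  open IntegerCoefficients R
  open import Relation.Binary.Reasoning.Setoid setoid

  *-cancel-inverse : ∀ {a b c d} → a ≈ c * b → d * c ≈ 1# → a * d ≈ b
  *-cancel-inverse {a} {b} {c} {d} a≈cb dc≈1 = begin
    a * d        ≈⟨ *-cong a≈cb refl ⟩
    (c * b) * d  ≈⟨ solve 3 (λ b c d → (c :* b) :* d := (d :* c) :* b) refl b c d ⟩
    (d * c) * b  ≈⟨ *-cong dc≈1 refl ⟩
    1# * b       ≈⟨ *-identityˡ b ⟩
    b            ∎

  trace-conjugate-term : ∀ {m m′ h g o d} → m * h + m′ * g ≈ - (h * o) → h * d ≈ 1# → (m′ * g) * d ≈ - (o + m)
  trace-conjugate-term {m} {m′} {h} {g} {o} {d} trace hd≈1 = begin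
    (m′ * g) * d                           ≈⟨ solve 5 (λ m m′ h g d → (m′ :* g) :* d := (m :* h :+ m′ :* g) :* d :- m :* (h :* d))
                                                      refl m m′ h g d ⟩
    (m * h + m′ * g) * d - m * (h * d)     ≈⟨ +-cong (*-cong trace refl) refl ⟩
    - (h * o) * d - m * (h * d)            ≈⟨ solve 4 (λ m h o d → :- (h :* o) :* d :- m :* (h :* d) := :- (o :* (h :* d)) :- m :* (h :* d))
                                                      refl m h o d ⟩
    - (o * (h * d)) - m * (h * d)          ≈⟨ +-cong (-‿cong (*-cong refl hd≈1)) (-‿cong (*-cong refl hd≈1)) ⟩
    - (o * 1#) - m * 1#                    ≈⟨ solve 2 (λ m o → :- (o :* con (+ 1)) :- m :* con (+ 1) := :- (o :+ m)) refl m o ⟩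
    - (o + m)                              ∎

  rescaled-trace : ∀ {m m′ h h′ w w′ Y} → m * h + m′ * h′ ≈ - Y → h * w′ ≈ 1# → h′ * w ≈ 1# →
                   (m * w + m′ * w′) + (w * w′) * Y ≈ 0#
  rescaled-trace {m} {m′} {h} {h′} {w} {w′} {Y} trace hw′≈1 h′w≈1 = begin
    (m * w + m′ * w′) + (w * w′) * Y                        ≈⟨ solve 5 (λ m m′ w w′ Y → (m :* w :+ m′ :* w′) :+ (w :* w′) :* Y
                                                                       := ((m :* w) :* con (+ 1) :+ (m′ :* w′) :* con (+ 1)) :+ (w :* w′) :* Y)
                                                                     refl m m′ w w′ Y ⟩
    ((m * w) * 1# + (m′ * w′) * 1#) + (w * w′) * Y          ≈⟨ +-cong (+-cong (*-cong refl (sym hw′≈1)) (*-cong refl (sym h′w≈1))) refl ⟩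
    ((m * w) * (h * w′) + (m′ * w′) * (h′ * w)) + (w * w′) * Y
                                                            ≈⟨ solve 7 (λ m m′ h h′ w w′ Y →
                                                                         ((m :* w) :* (h :* w′) :+ (m′ :* w′) :* (h′ :* w)) :+ (w :* w′) :* Y
                                                                       := (w :* w′) :* ((m :* h :+ m′ :* h′) :+ Y))
                                                                     refl m m′ h h′ w w′ Y ⟩
    (w * w′) * ((m * h + m′ * h′) + Y)                      ≈⟨ *-cong refl (+-cong trace refl) ⟩
    (w * w′) * (- Y + Y)                                    ≈⟨ solve 3 (λ w w′ Y → (w :* w′) :* (:- Y :+ Y) := con (+ 0)) refl w w′ Y ⟩
    0#                                                      ∎


module ValuationRing (K : NALocalField) where
  open NALocalField K
  open CommutativeRing ring using (sym; trans; *-identityʳ)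
  open import Algebra.Properties.Ring (CommutativeRing.ring ring) using (-1*x≈-x; -‿involutive)

  private
    ≤∞-trans : ∀ {a b c} → a ≤∞ b → b ≤∞ c → a ≤∞ c
    ≤∞-trans (fin≤fin a≤b) (fin≤fin b≤c) = fin≤fin (ℤ.≤-trans a≤b b≤c)
    ≤∞-trans {a} _ (_ ≤∞∞) = a ≤∞∞

    nonneg-+∞ : ∀ {a b} → fin (+ 0) ≤∞ a → fin (+ 0) ≤∞ b → fin (+ 0) ≤∞ (a +∞ b)
    nonneg-+∞ (fin≤fin (ℤ.+≤+ _)) (fin≤fin (ℤ.+≤+ _)) = fin≤fin (ℤ.+≤+ ℕ.z≤n)
    nonneg-+∞ (fin≤fin _)         (_ ≤∞∞)            = _ ≤∞∞
    nonneg-+∞ (_ ≤∞∞)             _                  = _ ≤∞∞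

    nonneg-half : ∀ {a} → fin (+ 0) ≤∞ (a +∞ a) → fin (+ 0) ≤∞ a
    nonneg-half {fin (+ n)}    _           = fin≤fin (ℤ.+≤+ ℕ.z≤n)
    nonneg-half {fin -[1+ n ]} (fin≤fin ())
    nonneg-half {∞}            _           = _ ≤∞∞

    nonneg-idempotent : ∀ {a} → a ≡ a +∞ a → fin (+ 0) ≤∞ a
    nonneg-idempotent {fin (+ n)}    _  = fin≤fin (ℤ.+≤+ ℕ.z≤n)
    nonneg-idempotent {fin -[1+ n ]} eq = ⊥-elim (ℕ.m≢1+m+n n (ℤ.-[1+-injective (fin-injective eq)))
      where
      fin-injective : ∀ {i j} → fin i ≡ fin j → i ≡ j
      fin-injective ≡.refl = ≡.refl
    nonneg-idempotent {∞}            _  = _ ≤∞∞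

  In𝔬-cong : ∀ {x y} → x ≈ y → In𝔬 x → In𝔬 y
  In𝔬-cong x≈y = ≡.subst (fin (+ 0) ≤∞_) (val-cong x≈y)

  In𝔬-0 : In𝔬 0#
  In𝔬-0 = ≡.subst (fin (+ 0) ≤∞_) (≡.sym (proj₂ (val-∞ 0#) (CommutativeRing.refl ring))) (_ ≤∞∞)

  In𝔬-1 : In𝔬 1#
  In𝔬-1 = nonneg-idempotent (≡.trans (val-cong (sym (*-identityʳ 1#))) (val-* 1# 1#))

  In𝔬-* : ∀ {x y} → In𝔬 x → In𝔬 y → In𝔬 (x * y)
  In𝔬-* {x} {y} x∈𝔬 y∈𝔬 = ≡.subst (fin (+ 0) ≤∞_) (≡.sym (val-* x y)) (nonneg-+∞ x∈𝔬 y∈𝔬)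

  In𝔬-+ : ∀ {x y} → In𝔬 x → In𝔬 y → In𝔬 (x + y)
  In𝔬-+ {x} {y} x∈𝔬 y∈𝔬 with val-+ x y
  ... | inj₁ vx≤ = ≤∞-trans x∈𝔬 vx≤
  ... | inj₂ vy≤ = ≤∞-trans y∈𝔬 vy≤

  In𝔬-neg : ∀ {x} → In𝔬 x → In𝔬 (- x)
  In𝔬-neg {x} x∈𝔬 = In𝔬-cong (-1*x≈-x x) (In𝔬-* minus-one∈𝔬 x∈𝔬)
    where
    minus-one∈𝔬 : In𝔬 (- 1#)
    minus-one∈𝔬 = nonneg-half (≡.subst (fin (+ 0) ≤∞_) (≡.trans (val-cong square) (val-* (- 1#) (- 1#))) In𝔬-1)
      where
      square : 1# ≈ - 1# * - 1#
      square = sym (trans (-1*x≈-x (- 1#)) (-‿involutive 1#))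


module SplitHermitian (K : NALocalField) where
  open NALocalField K using (ring; In𝔬) renaming (Carrier to Kc)
  open Hermitian K
  open ValuationRing K

  -- Its operations and equality are definitionally _+E_, _*E_, -E_, 0E, 1E and _≈E_.
  E-ring : CommutativeRing 0ℓ 0ℓ
  E-ring = DirectProduct.commutativeRing ring ring

  private
    module 𝕂 = CommutativeRing ring
    module 𝔼 = CommutativeRing E-ring
    module 𝕂-Solver = IntegerCoefficients ring
    module 𝔼-Solver = IntegerCoefficients E-ring

  bar-cong : ∀ {a b} → a ≈E b → bar a ≈E bar b
  bar-cong (a₁≈b₁ , a₂≈b₂) = a₂≈b₂ , a₁≈b₁

  In𝒪-cong : ∀ {a b} → a ≈E b → In𝒪 a → In𝒪 b
  In𝒪-cong (a₁≈b₁ , a₂≈b₂) (a₁∈𝔬 , a₂∈𝔬) = In𝔬-cong a₁≈b₁ a₁∈𝔬 , In𝔬-cong a₂≈b₂ a₂∈𝔬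

  In𝒪-0 : In𝒪 0E
  In𝒪-0 = In𝔬-0 , In𝔬-0

  In𝒪-1 : In𝒪 1E
  In𝒪-1 = In𝔬-1 , In𝔬-1

  In𝒪-+ : ∀ {a b} → In𝒪 a → In𝒪 b → In𝒪 (a +E b)
  In𝒪-+ (a₁ , a₂) (b₁ , b₂) = In𝔬-+ a₁ b₁ , In𝔬-+ a₂ b₂

  In𝒪-* : ∀ {a b} → In𝒪 a → In𝒪 b → In𝒪 (a *E b)
  In𝒪-* (a₁ , a₂) (b₁ , b₂) = In𝔬-* a₁ b₁ , In𝔬-* a₂ b₂

  In𝒪-neg : ∀ {a} → In𝒪 a → In𝒪 (-E a)
  In𝒪-neg (a₁ , a₂) = In𝔬-neg a₁ , In𝔬-neg a₂

  antidiag : Kc → E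
  antidiag t = t , 𝕂.- t

  Tr-antidiag : ∀ t → Tr (antidiag t) ≈E 0E
  Tr-antidiag t = 𝕂.-‿inverseʳ t , 𝕂.-‿inverseˡ t

  antidiag-inverse : ∀ {s t} → s 𝕂.* t 𝕂.≈ 𝕂.1# → (antidiag s *E antidiag t) ≈E 1E
  antidiag-inverse {s} {t} st≈1 = st≈1 , 𝕂.trans (neg*neg s t) st≈1
    where
    open 𝕂-Solver
    neg*neg : ∀ s t → 𝕂.- s 𝕂.* 𝕂.- t 𝕂.≈ s 𝕂.* t
    neg*neg = solve 2 (λ s t → :- s :* :- t := s :* t) 𝕂.refl

  module Geometry (H : HermitianSpace) where
    open HermitianSpace H
    open Lattices H
    open Setoid (Pointwise.setoid 𝔼.setoid n) public
      using () renaming (refl to ≈V-refl; sym to ≈V-sym; trans to ≈V-trans)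
    open import Relation.Binary.Reasoning.Setoid 𝔼.setoid

    ⟨⟩-+ʳ : ∀ x y z → ⟨ x , y +V z ⟩ ≈E (⟨ x , y ⟩ +E ⟨ x , z ⟩)
    ⟨⟩-+ʳ x y z = begin
      ⟨ x , y +V z ⟩                   ≈⟨ ⟨⟩-herm x (y +V z) ⟩
      bar ⟨ y +V z , x ⟩                ≈⟨ bar-cong (⟨⟩-+ y z x) ⟩
      bar ⟨ y , x ⟩ +E bar ⟨ z , x ⟩    ≈⟨ 𝔼.+-cong (⟨⟩-herm x y) (⟨⟩-herm x z) ⟨
      ⟨ x , y ⟩ +E ⟨ x , z ⟩            ∎

    ⟨⟩-·ʳ : ∀ c x y → ⟨ x , c · y ⟩ ≈E (bar c *E ⟨ x , y ⟩)
    ⟨⟩-·ʳ c x y = begin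
      ⟨ x , c · y ⟩           ≈⟨ ⟨⟩-herm x (c · y) ⟩
      bar ⟨ c · y , x ⟩        ≈⟨ bar-cong (⟨⟩-· c y x) ⟩
      bar c *E bar ⟨ y , x ⟩   ≈⟨ 𝔼.*-cong 𝔼.refl (⟨⟩-herm x y) ⟨
      bar c *E ⟨ x , y ⟩       ∎

    ⊥-sym : ∀ {x y} → ⟨ x , y ⟩ ≈E 0E → ⟨ y , x ⟩ ≈E 0E
    ⊥-sym {x} {y} x⊥y = 𝔼.trans (⟨⟩-herm y x) (bar-cong x⊥y)

    ⟨⟩-subˡ : ∀ x k s z → ⟨ x -V (k · s) , z ⟩ ≈E (⟨ x , z ⟩ -E (k *E ⟨ s , z ⟩))
    ⟨⟩-subˡ x k s z = begin
      ⟨ x -V (k · s) , z ⟩                ≈⟨ ⟨⟩-cong x-ks≈x+[-k]s ≈V-refl ⟩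
      ⟨ x +V ((-E k) · s) , z ⟩           ≈⟨ ⟨⟩-+ x ((-E k) · s) z ⟩
      ⟨ x , z ⟩ +E ⟨ (-E k) · s , z ⟩     ≈⟨ 𝔼.+-cong 𝔼.refl (⟨⟩-· (-E k) s z) ⟩
      ⟨ x , z ⟩ +E ((-E k) *E ⟨ s , z ⟩)  ≈⟨ 𝔼.+-cong 𝔼.refl (-‿distribˡ-* k ⟨ s , z ⟩) ⟨
      ⟨ x , z ⟩ -E (k *E ⟨ s , z ⟩)       ∎
      where
      open import Algebra.Properties.Ring 𝔼.ring using (-‿distribˡ-*)
      x-ks≈x+[-k]s : (x -V (k · s)) ≈V (x +V ((-E k) · s))
      x-ks≈x+[-k]s i = 𝔼.+-cong 𝔼.refl (-‿distribˡ-* k (s i))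

    ⟨⟩-subʳ : ∀ z x k s → ⟨ z , x -V (k · s) ⟩ ≈E (⟨ z , x ⟩ -E (bar k *E ⟨ z , s ⟩))
    ⟨⟩-subʳ z x k s = begin
      ⟨ z , x -V (k · s) ⟩                         ≈⟨ ⟨⟩-herm z (x -V (k · s)) ⟩
      bar ⟨ x -V (k · s) , z ⟩                      ≈⟨ bar-cong (⟨⟩-subˡ x k s z) ⟩
      bar ⟨ x , z ⟩ -E (bar k *E bar ⟨ s , z ⟩)     ≈⟨ 𝔼.+-cong (⟨⟩-herm z x) (𝔼.-‿cong (𝔼.*-cong 𝔼.refl (⟨⟩-herm z s))) ⟨
      ⟨ z , x ⟩ -E (bar k *E ⟨ z , s ⟩)            ∎

    ∈L-cong : ∀ {L x y} → x ≈V y → x ∈L L → y ∈L L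
    ∈L-cong x≈y (c , c∈𝒪 , x≈Σ) = c , c∈𝒪 , ≈V-trans (≈V-sym x≈y) x≈Σ

    sumV-linear : ∀ {m} a b (α β : Fin m → E) (g : Fin m → V n) →
      sumV (λ i → ((a *E α i) +E (b *E β i)) · g i)
        ≈V ((a · sumV (λ i → α i · g i)) +V (b · sumV (λ i → β i · g i)))
    sumV-linear {zero}  a b α β g j = solve 2 (λ a b → con (+ 0) := a :* con (+ 0) :+ b :* con (+ 0)) 𝔼.refl a b
      where open 𝔼-Solver
    sumV-linear {suc m} a b α β g j = begin
      (((a *E α zero) +E (b *E β zero)) *E g zero j) +E sumV (λ i → ((a *E α (suc i)) +E (b *E β (suc i))) · g (suc i)) j
        ≈⟨ 𝔼.+-cong 𝔼.refl (sumV-linear a b (α ∘ suc) (β ∘ suc) (g ∘ suc) j) ⟩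
      (((a *E α zero) +E (b *E β zero)) *E g zero j) +E ((a *E r) +E (b *E r′))
        ≈⟨ solve 7 (λ a b α β γ r r′ → (a :* α :+ b :* β) :* γ :+ (a :* r :+ b :* r′)
                                    := a :* (α :* γ :+ r) :+ b :* (β :* γ :+ r′)) 𝔼.refl
                   a b (α zero) (β zero) (g zero j) r r′ ⟩
      (a *E ((α zero *E g zero j) +E r)) +E (b *E ((β zero *E g zero j) +E r′))
        ∎
      where
      open 𝔼-Solver
      r r′ : E
      r  = sumV (λ i → α (suc i) · g (suc i)) j
      r′ = sumV (λ i → β (suc i) · g (suc i)) j

    ∈L-combination : ∀ {L a b x y} → In𝒪 a → In𝒪 b → x ∈L L → y ∈L L → ((a · x) +V (b · y)) ∈L L
    ∈L-combination {L} {a} {b} a∈𝒪 b∈𝒪 (α , α∈𝒪 , x≈Σα) (β , β∈𝒪 , y≈Σβ) =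
      (λ i → (a *E α i) +E (b *E β i)) ,
      (λ i → In𝒪-+ (In𝒪-* a∈𝒪 (α∈𝒪 i)) (In𝒪-* b∈𝒪 (β∈𝒪 i))) ,
      ≈V-trans (λ j → 𝔼.+-cong (𝔼.*-cong 𝔼.refl (x≈Σα j)) (𝔼.*-cong 𝔼.refl (y≈Σβ j)))
               (≈V-sym (sumV-linear a b α β (Lattice.gens L)))

    ∈L-sub : ∀ {L k x s} → In𝒪 k → x ∈L L → s ∈L L → (x -V (k · s)) ∈L L
    ∈L-sub {k = k} {x} {s} k∈𝒪 x∈L s∈L =
      ∈L-cong (λ i → solve 3 (λ k x s → con (+ 1) :* x :+ (:- k) :* s := x :- k :* s) 𝔼.refl k (x i) (s i))
              (∈L-combination In𝒪-1 (In𝒪-neg k∈𝒪) x∈L s∈L)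
      where open 𝔼-Solver

    id-InUL : ∀ {L} → InUL L (λ x → x)
    id-InUL = record
      { unitary = record
        { cong = λ x≈y → x≈y ; additive = λ _ _ → ≈V-refl ; homog = λ _ _ → ≈V-refl
        ; inj = λ _ _ x≈y → x≈y ; surj = λ y → y , ≈V-refl ; isom = λ _ _ → 𝔼.refl }
      ; maps = λ _ x∈L → x∈L
      ; onto = λ y y∈L → y , y∈L , ≈V-refl
      }

    S-unfold : ∀ s c x {a} → ⟨ x , s ⟩ ≈E a → ∀ i → S s c x i ≈E (x i -E ((a *E c) *E s i))
    S-unfold s c x xs≈a i = 𝔼.+-cong 𝔼.refl (𝔼.-‿cong (𝔼.*-cong (𝔼.*-cong xs≈a 𝔼.refl) 𝔼.refl))

    module Transvection (s : V n) (s-isotropic : ⟨ s , s ⟩ ≈E 0E) where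
      open 𝔼-Solver using (solve; _:+_; _:*_; _:-_; :-_; _:=_; con)

      S-cong : ∀ c {x y} → x ≈V y → S s c x ≈V S s c y
      S-cong c {x} x≈y i = 𝔼.trans (S-unfold s c x (⟨⟩-cong x≈y ≈V-refl) i) (𝔼.+-cong (x≈y i) 𝔼.refl)

      S-+ : ∀ c x y → S s c (x +V y) ≈V (S s c x +V S s c y)
      S-+ c x y i = 𝔼.trans (S-unfold s c (x +V y) (⟨⟩-+ x y s) i)
        (solve 6 (λ a b p q c t → (a :+ b) :- ((p :+ q) :* c) :* t := (a :- (p :* c) :* t) :+ (b :- (q :* c) :* t))
               𝔼.refl (x i) (y i) ⟨ x , s ⟩ ⟨ y , s ⟩ c (s i))

      S-· : ∀ c d x → S s c (d · x) ≈V (d · S s c x)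
      S-· c d x i = 𝔼.trans (S-unfold s c (d · x) (⟨⟩-· d x s) i)
        (solve 5 (λ d a p c t → d :* a :- ((d :* p) :* c) :* t := d :* (a :- (p :* c) :* t))
               𝔼.refl d (x i) ⟨ x , s ⟩ c (s i))

      ⟨S,s⟩ : ∀ c x → ⟨ S s c x , s ⟩ ≈E ⟨ x , s ⟩
      ⟨S,s⟩ c x = begin
        ⟨ S s c x , s ⟩                            ≈⟨ ⟨⟩-subˡ x (⟨ x , s ⟩ *E c) s s ⟩
        ⟨ x , s ⟩ -E ((⟨ x , s ⟩ *E c) *E ⟨ s , s ⟩) ≈⟨ 𝔼.+-cong 𝔼.refl (𝔼.-‿cong (𝔼.*-cong 𝔼.refl s-isotropic)) ⟩
        ⟨ x , s ⟩ -E ((⟨ x , s ⟩ *E c) *E 0E)        ≈⟨ solve 2 (λ a k → a :- k :* con (+ 0) := a) 𝔼.refl ⟨ x , s ⟩ (⟨ x , s ⟩ *E c) ⟩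
        ⟨ x , s ⟩                                  ∎

      S-inverse : ∀ c d → (c +E d) ≈E 0E → ∀ x → S s c (S s d x) ≈V x
      S-inverse c d c+d≈0 x i = begin
        S s c (S s d x) i                                          ≈⟨ S-unfold s c (S s d x) (⟨S,s⟩ d x) i ⟩
        (x i -E ((p *E d) *E s i)) -E ((p *E c) *E s i)            ≈⟨ solve 5 (λ a p c d t → (a :- (p :* d) :* t) :- (p :* c) :* t
                                                                                    := a :- (p :* (c :+ d)) :* t) 𝔼.refl (x i) p c d (s i) ⟩
        x i -E ((p *E (c +E d)) *E s i)                            ≈⟨ 𝔼.+-cong 𝔼.refl (𝔼.-‿cong (𝔼.*-cong (𝔼.*-cong 𝔼.refl c+d≈0) 𝔼.refl)) ⟩
        x i -E ((p *E 0E) *E s i)                                  ≈⟨ solve 3 (λ a p t → a :- (p :* con (+ 0)) :* t := a) 𝔼.refl (x i) p (s i) ⟩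
        x i                                                        ∎
        where p = ⟨ x , s ⟩

      S-isometry : ∀ c → Tr c ≈E 0E → ∀ x z → ⟨ S s c x , S s c z ⟩ ≈E ⟨ x , z ⟩
      S-isometry c c-skew x z = begin
        ⟨ S s c x , S s c z ⟩
          ≈⟨ ⟨⟩-subˡ x (p *E c) s (S s c z) ⟩
        ⟨ x , S s c z ⟩ -E ((p *E c) *E ⟨ s , S s c z ⟩)
          ≈⟨ 𝔼.+-cong (⟨⟩-subʳ x z (⟨ z , s ⟩ *E c) s) (𝔼.-‿cong (𝔼.*-cong 𝔼.refl (⟨⟩-subʳ s z (⟨ z , s ⟩ *E c) s))) ⟩
        (⟨ x , z ⟩ -E ((bar ⟨ z , s ⟩ *E bar c) *E p)) -E ((p *E c) *E (q -E ((bar ⟨ z , s ⟩ *E bar c) *E ⟨ s , s ⟩)))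
          ≈⟨ 𝔼.+-cong (𝔼.+-cong 𝔼.refl (𝔼.-‿cong (𝔼.*-cong (𝔼.*-cong zs≈q 𝔼.refl) 𝔼.refl)))
                      (𝔼.-‿cong (𝔼.*-cong 𝔼.refl (𝔼.+-cong 𝔼.refl (𝔼.-‿cong (𝔼.*-cong (𝔼.*-cong zs≈q 𝔼.refl) s-isotropic))))) ⟩
        (⟨ x , z ⟩ -E ((q *E bar c) *E p)) -E ((p *E c) *E (q -E ((q *E bar c) *E 0E)))
          ≈⟨ solve 5 (λ a p q c c̄ → (a :- (q :* c̄) :* p) :- (p :* c) :* (q :- (q :* c̄) :* con (+ 0))
                                    := a :- (p :* q) :* (c :+ c̄)) 𝔼.refl ⟨ x , z ⟩ p q c (bar c) ⟩
        ⟨ x , z ⟩ -E ((p *E q) *E Tr c)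
          ≈⟨ 𝔼.+-cong 𝔼.refl (𝔼.-‿cong (𝔼.*-cong 𝔼.refl c-skew)) ⟩
        ⟨ x , z ⟩ -E ((p *E q) *E 0E)
          ≈⟨ solve 2 (λ a k → a :- k :* con (+ 0) := a) 𝔼.refl ⟨ x , z ⟩ (p *E q) ⟩
        ⟨ x , z ⟩
          ∎
        where
        p q : E
        p = ⟨ x , s ⟩
        q = ⟨ s , z ⟩
        zs≈q : bar ⟨ z , s ⟩ ≈E q
        zs≈q = 𝔼.sym (⟨⟩-herm s z)

      S-InUV : ∀ c → Tr c ≈E 0E → InUV (S s c)
      S-InUV c c-skew = record
        { cong     = S-cong c
        ; additive = S-+ c
        ; homog    = S-· c
        ; inj      = λ x y Sx≈Sy → ≈V-trans (≈V-sym (S-inverse (-E c) c (𝔼.-‿inverseˡ c) x))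
                                   (≈V-trans (S-cong (-E c) Sx≈Sy) (S-inverse (-E c) c (𝔼.-‿inverseˡ c) y))
        ; surj     = λ y → S s (-E c) y , S-inverse c (-E c) (𝔼.-‿inverseʳ c) y
        ; isom     = S-isometry c c-skew
        }

      S-InUL : ∀ {L} c → Tr c ≈E 0E → s ∈L L → (∀ x → x ∈L L → In𝒪 (⟨ x , s ⟩ *E c)) → InUL L (S s c)
      S-InUL c c-skew s∈L integral = record
        { unitary = S-InUV c c-skew
        ; maps    = λ x x∈L → ∈L-sub (integral x x∈L) x∈L s∈L
        ; onto    = λ y y∈L → S s (-E c) y
                            , ∈L-sub (In𝒪-cong (-‿distribʳ-* ⟨ y , s ⟩ c) (In𝒪-neg (integral y y∈L))) y∈L s∈L
                            , S-inverse c (-E c) (𝔼.-‿inverseʳ c) y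
        }
        where open import Algebra.Properties.Ring 𝔼.ring using (-‿distribʳ-*)

      S-isSymmetry : ∀ {L σ c} → (σ *E c) ≈E 1E → Tr σ ≈E 0E → Tr c ≈E 0E → s ∈L L →
                     (∀ x → x ∈L L → In𝒪 (⟨ x , s ⟩ *E c)) → IsSymmetry L (S s c)
      S-isSymmetry {σ = σ} {c} σc≈1 σ-skew c-skew s∈L integral =
        s , σ , c , σc≈1 , 𝔼.trans s-isotropic (𝔼.sym σ-skew) , (λ x → ≈V-refl) , S-InUL c c-skew s∈L integral

    glue : V n → V n → V n
    glue p q i = proj₁ (p i) , proj₂ (q i)

    private
      ε ε̄ : E
      ε = 𝕂.1# , 𝕂.0#
      ε̄ = 𝕂.0# , 𝕂.1#

      ε-combination : (a b : E) → ((ε *E a) +E (ε̄ *E b)) ≈E (proj₁ a , proj₂ b)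
      ε-combination (a₁ , a₂) (b₁ , b₂) =
          solve 2 (λ a b → con (+ 1) :* a :+ con (+ 0) :* b := a) 𝕂.refl a₁ b₁
        , solve 2 (λ a b → con (+ 0) :* a :+ con (+ 1) :* b := b) 𝕂.refl a₂ b₂
        where open 𝕂-Solver

    glue-≈ : ∀ p q → glue p q ≈V ((ε · p) +V (ε̄ · q))
    glue-≈ p q i = 𝔼.sym (ε-combination (p i) (q i))

    ⟨glue⟩ˡ : ∀ p q z → ⟨ glue p q , z ⟩ ≈E (proj₁ ⟨ p , z ⟩ , proj₂ ⟨ q , z ⟩)
    ⟨glue⟩ˡ p q z = begin
      ⟨ glue p q , z ⟩                          ≈⟨ ⟨⟩-cong (glue-≈ p q) ≈V-refl ⟩
      ⟨ (ε · p) +V (ε̄ · q) , z ⟩                ≈⟨ ⟨⟩-+ (ε · p) (ε̄ · q) z ⟩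
      ⟨ ε · p , z ⟩ +E ⟨ ε̄ · q , z ⟩            ≈⟨ 𝔼.+-cong (⟨⟩-· ε p z) (⟨⟩-· ε̄ q z) ⟩
      (ε *E ⟨ p , z ⟩) +E (ε̄ *E ⟨ q , z ⟩)      ≈⟨ ε-combination ⟨ p , z ⟩ ⟨ q , z ⟩ ⟩
      (proj₁ ⟨ p , z ⟩ , proj₂ ⟨ q , z ⟩)       ∎

    ⟨glue⟩ʳ : ∀ z p q → ⟨ z , glue p q ⟩ ≈E (proj₁ ⟨ z , q ⟩ , proj₂ ⟨ z , p ⟩)
    ⟨glue⟩ʳ z p q = begin
      ⟨ z , glue p q ⟩                          ≈⟨ ⟨⟩-herm z (glue p q) ⟩
      bar ⟨ glue p q , z ⟩                      ≈⟨ bar-cong (⟨glue⟩ˡ p q z) ⟩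
      (proj₂ ⟨ q , z ⟩ , proj₁ ⟨ p , z ⟩)       ≈⟨ proj₂ (⟨⟩-herm q z) , proj₁ (⟨⟩-herm p z) ⟩
      (proj₁ ⟨ z , q ⟩ , proj₂ ⟨ z , p ⟩)       ∎

    glue-isotropic : ∀ {p q} → ⟨ p , q ⟩ ≈E 0E → ⟨ glue p q , glue p q ⟩ ≈E 0E
    glue-isotropic {p} {q} p⊥q = begin
      ⟨ glue p q , glue p q ⟩                                      ≈⟨ ⟨glue⟩ˡ p q (glue p q) ⟩
      (proj₁ ⟨ p , glue p q ⟩ , proj₂ ⟨ q , glue p q ⟩)            ≈⟨ proj₁ (⟨glue⟩ʳ p p q) , proj₂ (⟨glue⟩ʳ q p q) ⟩
      (proj₁ ⟨ p , q ⟩ , proj₂ ⟨ q , p ⟩)                          ≈⟨ proj₁ p⊥q , proj₂ (⊥-sym p⊥q) ⟩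
      0E                                                           ∎

    glue-∈L : ∀ {L p q} → p ∈L L → q ∈L L → glue p q ∈L L
    glue-∈L {p = p} {q} p∈L q∈L =
      ∈L-cong (≈V-sym (glue-≈ p q)) (∈L-combination (In𝔬-1 , In𝔬-0) (In𝔬-0 , In𝔬-1) p∈L q∈L)

    module EichlerFactorisation
        (L : Lattice) (u v : V n) (split : HyperbolicSplitting L u v)
        (y : V n) (μ w : E) (y∈P⊥ : y ∈P⊥[ L , u , v ])
        (y-integral : ∀ x → x ∈L L → Σ E λ o → In𝒪 o × (⟨ x , y ⟩ ≈E (⟨ u , v ⟩ *E o)))
        (μ∈𝒪 : In𝒪 μ) (trace : Tr (μ *E ⟨ u , v ⟩) ≈E (-E ⟨ y , y ⟩))
        (w-inverse : (w *E ⟨ v , u ⟩) ≈E 1E) where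
      open HyperbolicSplitting split
      open InverseLemmas E-ring

      u∈P : u ∈P[ u , v ]
      u∈P = 1E , 0E , In𝒪-1 , In𝒪-0 , λ i →
        solve 2 (λ u v → u := con (+ 1) :* u :+ con (+ 0) :* v) 𝔼.refl (u i) (v i)
        where open 𝔼-Solver

      y⊥u : ⟨ y , u ⟩ ≈E 0E
      y⊥u = proj₂ y∈P⊥ u u∈P

      y′ : V n
      y′ = y +V (μ · u)

      y′∈L : y′ ∈L L
      y′∈L = ∈L-cong (λ i → solve 3 (λ y μ u → con (+ 1) :* y :+ μ :* u := y :+ μ :* u) 𝔼.refl (y i) μ (u i))
                     (∈L-combination In𝒪-1 μ∈𝒪 (proj₁ y∈P⊥) u∈L)
        where open 𝔼-Solver

      ⟨x,y′⟩-expand : ∀ x → ⟨ x , y′ ⟩ ≈E (⟨ x , y ⟩ +E (bar μ *E ⟨ x , u ⟩))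
      ⟨x,y′⟩-expand x = 𝔼.trans (⟨⟩-+ʳ x y (μ · u)) (𝔼.+-cong 𝔼.refl (⟨⟩-·ʳ μ x u))

      y′⊥u : ⟨ y′ , u ⟩ ≈E 0E
      y′⊥u = begin
        ⟨ y′ , u ⟩                         ≈⟨ ⟨⟩-+ y (μ · u) u ⟩
        ⟨ y , u ⟩ +E ⟨ μ · u , u ⟩          ≈⟨ 𝔼.+-cong y⊥u (𝔼.trans (⟨⟩-· μ u u) (𝔼.*-cong 𝔼.refl u-iso)) ⟩
        0E +E (μ *E 0E)                    ≈⟨ solve 1 (λ μ → con (+ 0) :+ μ :* con (+ 0) := con (+ 0)) 𝔼.refl μ ⟩
        0E                                 ∎
        where open 𝔼-Solver

      ⟨u,v⟩-bar : bar ⟨ u , v ⟩ ≈E ⟨ v , u ⟩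
      ⟨u,v⟩-bar = bar-cong (⟨⟩-herm u v)

      bar-w-inverse : (bar w *E ⟨ u , v ⟩) ≈E 1E
      bar-w-inverse = 𝔼.trans (𝔼.*-cong 𝔼.refl (⟨⟩-herm u v)) (bar-cong w-inverse)

      ⟨x,u⟩-factor : ∀ x → x ∈L L → Σ E λ β → In𝒪 β × (⟨ x , u ⟩ ≈E (⟨ v , u ⟩ *E β))
      ⟨x,u⟩-factor x x∈L with spans x x∈L
      ... | p , q , (a , b , _ , b∈𝒪 , p≈au+bv) , (_ , q⊥P) , x≈p+q = b , b∈𝒪 , (begin
        ⟨ x , u ⟩                                     ≈⟨ ⟨⟩-cong x≈p+q ≈V-refl ⟩
        ⟨ p +V q , u ⟩                                ≈⟨ ⟨⟩-+ p q u ⟩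
        ⟨ p , u ⟩ +E ⟨ q , u ⟩                         ≈⟨ 𝔼.+-cong (⟨⟩-cong p≈au+bv ≈V-refl) (q⊥P u u∈P) ⟩
        ⟨ (a · u) +V (b · v) , u ⟩ +E 0E              ≈⟨ 𝔼.+-cong (⟨⟩-+ (a · u) (b · v) u) 𝔼.refl ⟩
        (⟨ a · u , u ⟩ +E ⟨ b · v , u ⟩) +E 0E         ≈⟨ 𝔼.+-cong (𝔼.+-cong (𝔼.trans (⟨⟩-· a u u) (𝔼.*-cong 𝔼.refl u-iso)) (⟨⟩-· b v u)) 𝔼.refl ⟩
        ((a *E 0E) +E (b *E ⟨ v , u ⟩)) +E 0E          ≈⟨ solve 3 (λ a b γ → (a :* con (+ 0) :+ b :* γ) :+ con (+ 0) := γ :* b) 𝔼.refl a b ⟨ v , u ⟩ ⟩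
        ⟨ v , u ⟩ *E b                                ∎)
        where open 𝔼-Solver

      ⟨x,u⟩w-integral : ∀ x → x ∈L L → In𝒪 (⟨ x , u ⟩ *E w)
      ⟨x,u⟩w-integral x x∈L =
        let β , β∈𝒪 , ⟨x,u⟩≈ = ⟨x,u⟩-factor x x∈L in
        In𝒪-cong (𝔼.sym (*-cancel-inverse ⟨x,u⟩≈ w-inverse)) β∈𝒪

      ⟨x,y⟩w̄-integral : ∀ x → x ∈L L → In𝒪 (⟨ x , y ⟩ *E bar w)
      ⟨x,y⟩w̄-integral x x∈L =
        let o , o∈𝒪 , ⟨x,y⟩≈ = y-integral x x∈L in
        In𝒪-cong (𝔼.sym (*-cancel-inverse ⟨x,y⟩≈ bar-w-inverse)) o∈𝒪

      μ̄⟨v,u⟩w̄-integral : In𝒪 ((bar μ *E ⟨ v , u ⟩) *E bar w)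
      μ̄⟨v,u⟩w̄-integral =
        let o , o∈𝒪 , ⟨y,y⟩≈ = y-integral y (proj₁ y∈P⊥) in
        In𝒪-cong (𝔼.sym (trace-conjugate-term
                     (𝔼.trans (𝔼.+-cong 𝔼.refl (𝔼.*-cong 𝔼.refl (𝔼.sym ⟨u,v⟩-bar))) (𝔼.trans trace (𝔼.-‿cong ⟨y,y⟩≈)))
                     (𝔼.trans (𝔼.*-comm ⟨ u , v ⟩ (bar w)) bar-w-inverse)))
                 (In𝒪-neg (In𝒪-+ o∈𝒪 μ∈𝒪))

      ⟨x,y′⟩w̄-integral : ∀ x → x ∈L L → In𝒪 (⟨ x , y′ ⟩ *E bar w)
      ⟨x,y′⟩w̄-integral x x∈L =
        let β , β∈𝒪 , ⟨x,u⟩≈ = ⟨x,u⟩-factor x x∈L in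
        In𝒪-cong (𝔼.sym (begin
          ⟨ x , y′ ⟩ *E bar w                                             ≈⟨ 𝔼.*-cong (⟨x,y′⟩-expand x) 𝔼.refl ⟩
          (⟨ x , y ⟩ +E (bar μ *E ⟨ x , u ⟩)) *E bar w                     ≈⟨ 𝔼.*-cong (𝔼.+-cong 𝔼.refl (𝔼.*-cong 𝔼.refl ⟨x,u⟩≈)) 𝔼.refl ⟩
          (⟨ x , y ⟩ +E (bar μ *E (⟨ v , u ⟩ *E β))) *E bar w               ≈⟨ solve 5 (λ b m γ β d → (b :+ m :* (γ :* β)) :* d := b :* d :+ ((m :* γ) :* d) :* β)
                                                                                     𝔼.refl ⟨ x , y ⟩ (bar μ) ⟨ v , u ⟩ β (bar w) ⟩
          (⟨ x , y ⟩ *E bar w) +E (((bar μ *E ⟨ v , u ⟩) *E bar w) *E β)   ∎))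
          (In𝒪-+ (⟨x,y⟩w̄-integral x x∈L) (In𝒪-* μ̄⟨v,u⟩w̄-integral β∈𝒪))
        where open 𝔼-Solver

      s₂ s₁ : V n
      s₂ = glue u y
      s₁ = glue y′ u

      c₂ c₁ : E
      c₂ = antidiag (proj₂ w)
      c₁ = bar (antidiag (proj₁ w))

      s₂-isSymmetry : IsSymmetry L (S s₂ c₂)
      s₂-isSymmetry =
        Transvection.S-isSymmetry s₂ (glue-isotropic (⊥-sym y⊥u))
          (antidiag-inverse (𝕂.trans (𝕂.*-comm _ _) (proj₂ w-inverse))) (Tr-antidiag _) (Tr-antidiag _)
          (glue-∈L u∈L (proj₁ y∈P⊥)) integral
        where
        open import Algebra.Properties.Ring 𝕂.ring using (-‿distribʳ-*)
        integral : ∀ x → x ∈L L → In𝒪 (⟨ x , s₂ ⟩ *E c₂)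
        integral x x∈L =
          In𝒪-cong (𝔼.sym (𝔼.trans (𝔼.*-cong (⟨glue⟩ʳ x u y) 𝔼.refl) (𝕂.refl , 𝕂.sym (-‿distribʳ-* _ _))))
                   (proj₁ (⟨x,y⟩w̄-integral x x∈L) , In𝔬-neg (proj₂ (⟨x,u⟩w-integral x x∈L)))

      s₁-isSymmetry : IsSymmetry L (S s₁ c₁)
      s₁-isSymmetry =
        Transvection.S-isSymmetry s₁ (glue-isotropic y′⊥u)
          (bar-cong (antidiag-inverse (𝕂.trans (𝕂.*-comm _ _) (proj₁ w-inverse)))) (bar-cong (Tr-antidiag _)) (bar-cong (Tr-antidiag _))
          (glue-∈L y′∈L u∈L) integral
        where
        open import Algebra.Properties.Ring 𝕂.ring using (-‿distribʳ-*)
        integral : ∀ x → x ∈L L → In𝒪 (⟨ x , s₁ ⟩ *E c₁)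
        integral x x∈L =
          In𝒪-cong (𝔼.sym (𝔼.trans (𝔼.*-cong (⟨glue⟩ʳ x y′ u) 𝔼.refl) (𝕂.sym (-‿distribʳ-* _ _) , 𝕂.refl)))
                   (In𝔬-neg (proj₁ (⟨x,u⟩w-integral x x∈L)) , proj₂ (⟨x,y′⟩w̄-integral x x∈L))

      ⟨y,y′⟩≈⟨y,y⟩ : ⟨ y , y′ ⟩ ≈E ⟨ y , y ⟩
      ⟨y,y′⟩≈⟨y,y⟩ = begin
        ⟨ y , y′ ⟩                          ≈⟨ ⟨x,y′⟩-expand y ⟩
        ⟨ y , y ⟩ +E (bar μ *E ⟨ y , u ⟩)     ≈⟨ 𝔼.+-cong 𝔼.refl (𝔼.*-cong 𝔼.refl y⊥u) ⟩
        ⟨ y , y ⟩ +E (bar μ *E 0E)           ≈⟨ 𝔼.+-cong 𝔼.refl (𝔼.zeroʳ (bar μ)) ⟩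
        ⟨ y , y ⟩ +E 0E                      ≈⟨ 𝔼.+-identityʳ ⟨ y , y ⟩ ⟩
        ⟨ y , y ⟩                            ∎

      ⟨s₂,s₁⟩≈ : ⟨ s₂ , s₁ ⟩ ≈E (𝕂.0# , proj₂ ⟨ y , y ⟩)
      ⟨s₂,s₁⟩≈ = begin
        ⟨ s₂ , s₁ ⟩                                  ≈⟨ ⟨glue⟩ˡ u y s₁ ⟩
        (proj₁ ⟨ u , s₁ ⟩ , proj₂ ⟨ y , s₁ ⟩)        ≈⟨ proj₁ (⟨glue⟩ʳ u y′ u) , proj₂ (⟨glue⟩ʳ y y′ u) ⟩
        (proj₁ ⟨ u , u ⟩ , proj₂ ⟨ y , y′ ⟩)         ≈⟨ proj₁ u-iso , proj₂ ⟨y,y′⟩≈⟨y,y⟩ ⟩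
        (𝕂.0# , proj₂ ⟨ y , y ⟩)                     ∎

      factorisation : ∀ x → Eichler u v y μ w x ≈V S s₁ c₁ (S s₂ c₂ x)
      factorisation x i = 𝔼.sym (𝔼.trans unfold (first-component , second-component))
        where
        open 𝕂-Solver
        z : V n
        z = S s₂ c₂ x

        a b ⟨x,s₂⟩′ ⟨z,s₁⟩′ unfolded : E
        a = ⟨ x , u ⟩
        b = ⟨ x , y ⟩
        ⟨x,s₂⟩′ = proj₁ b , proj₂ a
        ⟨z,s₁⟩′ = (proj₁ a , proj₂ (b +E (bar μ *E a))) -E ((⟨x,s₂⟩′ *E c₂) *E (𝕂.0# , proj₂ ⟨ y , y ⟩))
        unfolded = (x i -E ((⟨x,s₂⟩′ *E c₂) *E s₂ i)) -E ((⟨z,s₁⟩′ *E c₁) *E s₁ i)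

        ⟨x,s₂⟩≈ : ⟨ x , s₂ ⟩ ≈E ⟨x,s₂⟩′
        ⟨x,s₂⟩≈ = ⟨glue⟩ʳ x u y

        ⟨z,s₁⟩≈ : ⟨ z , s₁ ⟩ ≈E ⟨z,s₁⟩′
        ⟨z,s₁⟩≈ = begin
          ⟨ z , s₁ ⟩                                          ≈⟨ ⟨⟩-subˡ x (⟨ x , s₂ ⟩ *E c₂) s₂ s₁ ⟩
          ⟨ x , s₁ ⟩ -E ((⟨ x , s₂ ⟩ *E c₂) *E ⟨ s₂ , s₁ ⟩)   ≈⟨ 𝔼.+-cong ⟨x,s₁⟩≈ (𝔼.-‿cong (𝔼.*-cong (𝔼.*-cong ⟨x,s₂⟩≈ 𝔼.refl) ⟨s₂,s₁⟩≈)) ⟩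
          ⟨z,s₁⟩′                                             ∎
          where
          ⟨x,s₁⟩≈ : ⟨ x , s₁ ⟩ ≈E (proj₁ a , proj₂ (b +E (bar μ *E a)))
          ⟨x,s₁⟩≈ = 𝔼.trans (⟨glue⟩ʳ x y′ u) (𝕂.refl , proj₂ (⟨x,y′⟩-expand x))

        unfold : S s₁ c₁ z i ≈E unfolded
        unfold = 𝔼.trans (S-unfold s₁ c₁ z ⟨z,s₁⟩≈ i) (𝔼.+-cong (S-unfold s₂ c₂ x ⟨x,s₂⟩≈ i) 𝔼.refl)

        first-component : proj₁ unfolded 𝕂.≈ proj₁ (Eichler u v y μ w x i)
        first-component = solve 8 (λ x u y a b μ w₁ w₂ →
                   (x :- (b :* w₂) :* u) :- ((a :- (b :* w₂) :* con (+ 0)) :* :- w₁) :* (y :+ μ :* u)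
                := (x :+ (a :* w₁) :* y) :+ (μ :* (a :* w₁) :- b :* w₂) :* u)
                𝕂.refl (proj₁ (x i)) (proj₁ (u i)) (proj₁ (y i)) (proj₁ a) (proj₁ b) (proj₁ μ) (proj₁ w) (proj₂ w)

        -- The two sides differ by a₂ u₂ times the second coordinate of the rescaled trace condition.
        second-component : proj₂ unfolded 𝕂.≈ proj₂ (Eichler u v y μ w x i)
        second-component = 𝕂.trans
          (solve 10 (λ x u y a b μ₁ μ₂ w₁ w₂ Y →
                 (x :- (a :* :- w₂) :* y) :- (((b :+ μ₁ :* a) :- (a :* :- w₂) :* Y) :* w₁) :* u
              := ((x :+ (a :* w₂) :* y) :+ (μ₂ :* (a :* w₂) :- b :* w₁) :* u) :- (a :* u) :* ((μ₂ :* w₂ :+ μ₁ :* w₁) :+ (w₂ :* w₁) :* Y))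
             𝕂.refl (proj₂ (x i)) (proj₂ (u i)) (proj₂ (y i)) (proj₂ a) (proj₂ b) (proj₁ μ) (proj₂ μ) (proj₁ w) (proj₂ w) (proj₂ ⟨ y , y ⟩))
          (𝕂.trans (𝕂.+-cong 𝕂.refl (𝕂.-‿cong (𝕂.*-cong 𝕂.refl (proj₂ trace-rescaled))))
                   (solve 2 (λ e k → e :- k :* con (+ 0) := e) 𝕂.refl (proj₂ (Eichler u v y μ w x i)) (proj₂ a 𝕂.* proj₂ (u i))))
          where
          trace-rescaled : (((μ *E w) +E (bar μ *E bar w)) +E ((w *E bar w) *E ⟨ y , y ⟩)) ≈E 0E
          trace-rescaled = rescaled-trace trace (𝔼.trans (𝔼.*-comm _ _) bar-w-inverse)
                                          (𝔼.trans (𝔼.*-cong ⟨u,v⟩-bar 𝔼.refl) (𝔼.trans (𝔼.*-comm _ _) w-inverse))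

lemma4p7 : (K : NALocalField) →
    let open Hermitian K in
    (H : HermitianSpace) →
    let open HermitianSpace H in
    let open Lattices H in
    (L : Lattice) (u v : V n) →
    HyperbolicSplitting L u v →
    (y : V n) (μ w : E) →
    y ∈P⊥[ L , u , v ] →
    (∀ x → x ∈L L → Σ E λ o → In𝒪 o × (⟨ x , y ⟩ ≈E (⟨ u , v ⟩ *E o))) →
    In𝒪 μ →
    (Tr (μ *E ⟨ u , v ⟩) ≈E (-E ⟨ y , y ⟩)) →
    ((w *E ⟨ v , u ⟩) ≈E 1E) →
    Σ (V n → V n) λ s₁ → Σ (V n → V n) λ s₂ → Σ (V n → V n) λ g →
    IsSymmetry L s₁ × IsSymmetry L s₂ × InUL L g ×
    (∀ p → p ∈P[ u , v ] → g p ≈V p) ×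
    (∀ x → Eichler u v y μ w x ≈V s₁ (s₂ (g x)))
lemma4p7 K H L u v split y μ w y∈P⊥ y-integral μ∈𝒪 trace w-inverse =
  S s₁ c₁ , S s₂ c₂ , (λ x → x) ,
  s₁-isSymmetry , s₂-isSymmetry , id-InUL , (λ p _ → ≈V-refl) , factorisation
  where
  open Hermitian.Lattices K H using (S)
  open SplitHermitian.Geometry K H
  open EichlerFactorisation L u v split y μ w y∈P⊥ y-integral μ∈𝒪 trace w-inverse
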